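{- If $a_i$ is the first element of a special unit (a 4-unit$_{s,1}$, 4-unit$_{s,2}$ or 4-unit$_{s,3}$) of $A_n$, then $12i>n$.
   Context: Let $n\ge1$, $A_n=(a_1,\dots,a_n)$. For each $j\le n$ divisible by neither 2 nor 3 the layer $L_j$ is $\{a_{j2^k3^s}:k,s\ge0,\ j2^k3^s\le n\}$, with $a_{j2^k3^s}$ in row $s$, column $k$; each nonempty row $s$ is $a_{j3^s},a_{2j3^s},\dots$ in increasing order of $k$; row $0$ is the first row, row $1$ the second; the next row above/below row $s$ is row $s-1$/$s+1$. In each nonempty row, the unit of the row is the set of all its elements if the row has fewer than four elements, and its last four elements (largest $k$) otherwise; a unit with four elements is a 4-unit, written $\{a_i,a_{2i},a_{4i},a_{8i}\}$ with first element $a_i$. Special units: (1) 4-unit$_{s,1}$: the 4-unit in a layer $L_j$ with $|L_j|=9$ and $5\nmid j$; (2) 4-unit$_{s,2}$: the 4-unit in the first row of a layer $L_j$ with $5\nmid j$, where the first row has at least six elements and two more elements than the second row; (3) 4-unit$_{s,3}$: a 4-unit $\{a_i,a_{2i},a_{4i},a_{8i}\}$ in a layer $L_j$ with $5\nmid j$ such that $36\mid i$, and, with $R$ the row containing it, the next row above $R$ has two more elements than $R$ and the next row below $R$ has two fewer elements than $R$. -}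

module Defs where

open import Data.Nat using (ℕ; zero; suc; _+_; _*_; _∸_; _^_; _≤_; _<_; _≤?_)
open import Data.Nat.Divisibility using (_∣_)
open import Data.List using (List; length; filter; upTo; map)
open import Data.Nat.ListAction using (sum)
open import Data.Product using (_×_; Σ; ∃-syntax)
open import Data.Sum using (_⊎_)
open import Relation.Nullary using (¬_)
open import Relation.Binary.PropositionalEquality using (_≡_)

-- Elements a_m of A_n are identified with their indices m (1 ≤ m ≤ n).

LayerIndex : ℕ → ℕ → Set
LayerIndex n j = 1 ≤ j × j ≤ n × ¬ (2 ∣ j) × ¬ (3 ∣ j)

-- number of elements of row s of layer L_j of A_n, i.e. the number of
-- k ≥ 0 with j·3^s·2^k ≤ n (such k satisfy k < 2^k ≤ n, so k ≤ n suffices)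
rowSize : ℕ → ℕ → ℕ → ℕ
rowSize n j s = length (filter (λ k → j * 3 ^ s * 2 ^ k ≤? n) (upTo (suc n)))

-- |L_j| : sum of the row sizes (row s is empty once 3^s > n)
layerSize : ℕ → ℕ → ℕ
layerSize n j = sum (map (rowSize n j) (upTo (suc n)))

-- row s of L_j has a 4-unit (≥ 4 elements) and a_i is its first element:
-- the unit is the last four elements a_{j3^s 2^k}, k = r-4,…,r-1 (r = row size)
FirstOf4Unit : ℕ → ℕ → ℕ → ℕ → Set
FirstOf4Unit n j s i = 4 ≤ rowSize n j s × i ≡ j * 3 ^ s * 2 ^ (rowSize n j s ∸ 4)

Special1 : ℕ → ℕ → Set
Special1 n i = ∃[ j ] ∃[ s ]
  (LayerIndex n j × ¬ (5 ∣ j) × layerSize n j ≡ 9 × FirstOf4Unit n j s i)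

Special2 : ℕ → ℕ → Set
Special2 n i = ∃[ j ]
  (LayerIndex n j × ¬ (5 ∣ j) × 6 ≤ rowSize n j 0
   × rowSize n j 0 ≡ rowSize n j 1 + 2 × FirstOf4Unit n j 0 i)

-- 4-unit_{s,3}: in row R = s+1, the row above is row s, the row below is row s+2
Special3 : ℕ → ℕ → Set
Special3 n i = ∃[ j ] ∃[ s ]
  (LayerIndex n j × ¬ (5 ∣ j) × FirstOf4Unit n j (suc s) i × 36 ∣ i
   × rowSize n j s ≡ rowSize n j (suc s) + 2
   × rowSize n j (suc s) ≡ rowSize n j (suc (suc s)) + 2)

FirstOfSpecialUnit : ℕ → ℕ → Set
FirstOfSpecialUnit n i = Special1 n i ⊎ Special2 n i ⊎ Special3 n i

-- Write i = j·3^s·2^q for the first element of a 4-unit, so row s of L_j has q + 4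
-- elements. If 12i ≤ n, then 12i = j·3^(s+1)·2^(q+2) and 9i = j·3^(s+2)·2^q lie in L_j,
-- so row s+1 has at least q + 3 elements and row s+2 at least q + 1. Hence the next row
-- is at most one element shorter, which excludes 4-units_{s,2} and _{s,3}. For a
-- 4-unit_{s,1}, three consecutive rows already hold ten elements unless s = q = 0; then
-- 12j ≤ n < 16j and L_j = {j, 2j, 4j, 8j, 3j, 6j, 12j, 9j} has only eight.
module Submission where

open import Defs
open import Data.Nat using (ℕ; zero; suc; _+_; _*_; _∸_; _^_; _≤_; _<_; _≤?_; z≤n; s≤s; >-nonZero)
open import Data.Nat.Properties
open import Data.Nat.ListAction using (sum)
open import Data.Nat.ListAction.Properties using (sum-++)
open import Data.Nat.Tactic.RingSolver using (solve-∀)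
open import Data.List using ([]; _∷_; _++_; length; filter; map; upTo)
open import Data.List.Properties using (filter-++; filter-reject; filter-all; length-++; length-filter; length-upTo; map-++; upTo-∷ʳ)
open import Data.List.Relation.Unary.All.Properties using (applyUpTo⁺₁)
open import Data.Product using (_×_; _,_; proj₁; proj₂; ∃-syntax)
open import Data.Sum using (inj₁; inj₂)
open import Relation.Nullary using (¬_; yes; no; contradiction)
open import Relation.Unary using (Decidable)
open import Relation.Binary.PropositionalEquality using (_≡_; _≢_; refl; sym; cong; subst; module ≡-Reasoning)
open import Function using (id; _∘′_)

n<2^n : ∀ n → n < 2 ^ n
n<2^n zero    = s≤s z≤n
n<2^n (suc n) = +-mono-≤ (≤-trans (s≤s z≤n) 1+n≤2^n) (≤-trans 1+n≤2^n (m≤m+n (2 ^ n) 0))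
  where
  1+n≤2^n : suc n ≤ 2 ^ n
  1+n≤2^n = n<2^n n

mono-by-steps : ∀ (g : ℕ → ℕ) → (∀ N → g N ≤ g (suc N)) → ∀ {M N} → M ≤ N → g M ≤ g N
mono-by-steps g step {N = zero}  z≤n = ≤-refl
mono-by-steps g step {M} {suc N} M≤1+N with m≤n⇒m<n∨m≡n M≤1+N
... | inj₁ M<1+N = ≤-trans (mono-by-steps g step (≤-pred M<1+N)) (step N)
... | inj₂ refl  = ≤-refl

module _ {P : ℕ → Set} (P? : Decidable P) where

  countBelow : ℕ → ℕ
  countBelow N = length (filter P? (upTo N))

  countBelow-suc : ∀ N → countBelow (suc N) ≡ countBelow N + length (filter P? (N ∷ []))
  countBelow-suc N = begin
    length (filter P? (upTo (suc N)))                  ≡⟨ cong (length ∘′ filter P?) (upTo-∷ʳ N) ⟨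
    length (filter P? (upTo N ++ N ∷ []))              ≡⟨ cong length (filter-++ P? (upTo N) (N ∷ [])) ⟩
    length (filter P? (upTo N) ++ filter P? (N ∷ []))  ≡⟨ length-++ (filter P? (upTo N)) ⟩
    countBelow N + length (filter P? (N ∷ []))         ∎
    where open ≡-Reasoning

  countBelow≤N : ∀ N → countBelow N ≤ N
  countBelow≤N N = ≤-trans (length-filter P? (upTo N)) (≤-reflexive (length-upTo N))

  countBelow-mono : ∀ {M N} → M ≤ N → countBelow M ≤ countBelow N
  countBelow-mono = mono-by-steps countBelow λ N → begin
    countBelow N                                ≤⟨ m≤m+n (countBelow N) _ ⟩
    countBelow N + length (filter P? (N ∷ []))  ≡⟨ countBelow-suc N ⟨
    countBelow (suc N)                          ∎
    where open ≤-Reasoning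

  ≤-countBelow : ∀ {t N} → t ≤ N → (∀ {k} → k < t → P k) → t ≤ countBelow N
  ≤-countBelow {t} {N} t≤N Pk = begin
    t                             ≡⟨ length-upTo t ⟨
    length (upTo t)               ≡⟨ cong length (filter-all P? (applyUpTo⁺₁ id t Pk)) ⟨
    countBelow t                  ≤⟨ countBelow-mono t≤N ⟩
    countBelow N                  ∎
    where open ≤-Reasoning

  countBelow-≤ : ∀ {t} N → (∀ {k} → t ≤ k → ¬ P k) → countBelow N ≤ t
  countBelow-≤     zero    ¬Pk = z≤n
  countBelow-≤ {t} (suc N) ¬Pk with t ≤? N
  ... | no  t≰N = ≤-trans (countBelow≤N (suc N)) (≰⇒> t≰N)
  ... | yes t≤N = begin
    countBelow (suc N)                          ≡⟨ countBelow-suc N ⟩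
    countBelow N + length (filter P? (N ∷ []))  ≡⟨ cong (λ xs → countBelow N + length xs) (filter-reject P? (¬Pk t≤N)) ⟩
    countBelow N + 0                            ≡⟨ +-identityʳ _ ⟩
    countBelow N                                ≤⟨ countBelow-≤ N ¬Pk ⟩
    t                                           ∎
    where open ≤-Reasoning

doubling≤? : ∀ m n → Decidable (λ k → m * 2 ^ k ≤ n)
doubling≤? m n k = m * 2 ^ k ≤? n

-- rowSize n j s is definitionally chainLength (j * 3 ^ s) n.
chainLength : ℕ → ℕ → ℕ
chainLength m n = countBelow (doubling≤? m n) (suc n)

<-chainLength : ∀ {m n t} → 1 ≤ m → m * 2 ^ t ≤ n → t < chainLength m n
<-chainLength {m} {n} {t} 1≤m m2^t≤n = ≤-countBelow (doubling≤? m n) (s≤s t≤n) m2^k≤n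
  where
  t≤n : t ≤ n
  t≤n = begin
    t          ≤⟨ <⇒≤ (n<2^n t) ⟩
    2 ^ t      ≤⟨ m≤n*m (2 ^ t) m {{>-nonZero 1≤m}} ⟩
    m * 2 ^ t  ≤⟨ m2^t≤n ⟩
    n          ∎
    where open ≤-Reasoning
  m2^k≤n : ∀ {k} → k < suc t → m * 2 ^ k ≤ n
  m2^k≤n k<1+t = ≤-trans (*-monoʳ-≤ m (^-monoʳ-≤ 2 (≤-pred k<1+t))) m2^t≤n

chainLength-≤ : ∀ {m n t} → n < m * 2 ^ t → chainLength m n ≤ t
chainLength-≤ {m} {n} {t} n<m2^t = countBelow-≤ (doubling≤? m n) (suc n)
  (λ t≤k m2^k≤n → <⇒≱ n<m2^t (≤-trans (*-monoʳ-≤ m (^-monoʳ-≤ 2 t≤k)) m2^k≤n))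

chainLength-last : ∀ {m n t} → chainLength m n ≡ suc t → m * 2 ^ t ≤ n
chainLength-last {m} {n} {t} len≡1+t with m * 2 ^ t ≤? n
... | yes m2^t≤n = m2^t≤n
... | no  m2^t≰n = contradiction (subst (_≤ t) len≡1+t (chainLength-≤ {m} {n} (≰⇒> m2^t≰n))) (n≮n t)

chainLength-nonempty : ∀ {m n} → 0 < chainLength m n → m ≤ n
chainLength-nonempty {m} {n} pos = ≮⇒≥ λ n<m →
  <⇒≱ pos (chainLength-≤ {m} {n} {0} (subst (_ <_) (sym (*-identityʳ m)) n<m))

prefixSum : (ℕ → ℕ) → ℕ → ℕ
prefixSum f N = sum (map f (upTo N))

module _ (f : ℕ → ℕ) where

  prefixSum-suc : ∀ N → prefixSum f (suc N) ≡ prefixSum f N + f N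
  prefixSum-suc N = begin
    sum (map f (upTo (suc N)))        ≡⟨ cong (sum ∘′ map f) (upTo-∷ʳ N) ⟨
    sum (map f (upTo N ++ N ∷ []))    ≡⟨ cong sum (map-++ f (upTo N) (N ∷ [])) ⟩
    sum (map f (upTo N) ++ f N ∷ [])  ≡⟨ sum-++ (map f (upTo N)) (f N ∷ []) ⟩
    prefixSum f N + (f N + 0)         ≡⟨ cong (prefixSum f N +_) (+-identityʳ (f N)) ⟩
    prefixSum f N + f N               ∎
    where open ≡-Reasoning

  prefixSum-mono : ∀ {M N} → M ≤ N → prefixSum f M ≤ prefixSum f N
  prefixSum-mono = mono-by-steps (prefixSum f) λ N →
    ≤-trans (m≤m+n (prefixSum f N) (f N)) (≤-reflexive (sym (prefixSum-suc N)))

  prefixSum-window : ∀ s {N} → 3 + s ≤ N → f s + f (1 + s) + f (2 + s) ≤ prefixSum f N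
  prefixSum-window s {N} 3+s≤N = begin
    f s + f (1 + s) + f (2 + s)                  ≤⟨ +-monoˡ-≤ _ (+-monoˡ-≤ _ (m≤n+m (f s) (prefixSum f s))) ⟩
    prefixSum f s + f s + f (1 + s) + f (2 + s)  ≡⟨ cong (λ x → x + f (1 + s) + f (2 + s)) (prefixSum-suc s) ⟨
    prefixSum f (1 + s) + f (1 + s) + f (2 + s)  ≡⟨ cong (_+ f (2 + s)) (prefixSum-suc (1 + s)) ⟨
    prefixSum f (2 + s) + f (2 + s)              ≡⟨ prefixSum-suc (2 + s) ⟨
    prefixSum f (3 + s)                          ≤⟨ prefixSum-mono 3+s≤N ⟩
    prefixSum f N                                ∎
    where open ≤-Reasoning

  prefixSum-vanishing : ∀ {M N} → (∀ {k} → M ≤ k → f k ≡ 0) → M ≤ N → prefixSum f N ≡ prefixSum f M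
  prefixSum-vanishing {N = zero} vanish z≤n = refl
  prefixSum-vanishing {M} {suc N} vanish M≤1+N with m≤n⇒m<n∨m≡n M≤1+N
  ... | inj₂ refl  = refl
  ... | inj₁ M<1+N = begin
    prefixSum f (suc N)  ≡⟨ prefixSum-suc N ⟩
    prefixSum f N + f N  ≡⟨ cong (prefixSum f N +_) (vanish M≤N) ⟩
    prefixSum f N + 0    ≡⟨ +-identityʳ _ ⟩
    prefixSum f N        ≡⟨ prefixSum-vanishing vanish M≤N ⟩
    prefixSum f M        ∎
    where
    open ≡-Reasoning
    M≤N : M ≤ N
    M≤N = ≤-pred M<1+N

4-unit-shape : ∀ {n j s i} → FirstOf4Unit n j s i →
               ∃[ q ] rowSize n j s ≡ 4 + q × i ≡ j * 3 ^ s * 2 ^ q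
4-unit-shape (4≤r , i≡) = _ , sym (m+[n∸m]≡n 4≤r) , i≡

module Rows {n j : ℕ} (1≤j : 1 ≤ j) where

  <-rowSize : ∀ s {k} → j * 3 ^ s * 2 ^ k ≤ n → k < rowSize n j s
  <-rowSize s = <-chainLength (*-mono-≤ 1≤j (m^n>0 3 s))

  rowSize-nonempty : ∀ s → 0 < rowSize n j s → s < n
  rowSize-nonempty s nonempty = begin-strict
    s          <⟨ n<2^n s ⟩
    2 ^ s      ≤⟨ ^-monoˡ-≤ s (n≤1+n 2) ⟩
    3 ^ s      ≤⟨ m≤n*m (3 ^ s) j {{>-nonZero 1≤j}} ⟩
    j * 3 ^ s  ≤⟨ chainLength-nonempty {j * 3 ^ s} {n} nonempty ⟩
    n          ∎
    where open ≤-Reasoning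

  rowSize-shift : ∀ s e d → 2 ^ e ≤ 3 ^ d → rowSize n j (d + s) ≤ rowSize n j s ∸ e
  rowSize-shift s e d 2^e≤3^d with rowSize n j (d + s) in len≡1+q
  ... | zero  = z≤n
  ... | suc q = m+n≤o⇒m≤o∸n (suc q) (<-rowSize s (begin
    j * 3 ^ s * 2 ^ (q + e)      ≡⟨ cong (j * 3 ^ s *_) (^-distribˡ-+-* 2 q e) ⟩
    j * 3 ^ s * (2 ^ q * 2 ^ e)  ≡⟨ *-assoc (j * 3 ^ s) (2 ^ q) (2 ^ e) ⟨
    j * 3 ^ s * 2 ^ q * 2 ^ e    ≤⟨ *-monoʳ-≤ (j * 3 ^ s * 2 ^ q) 2^e≤3^d ⟩
    j * 3 ^ s * 2 ^ q * 3 ^ d    ≡⟨ interchange j (3 ^ s) (2 ^ q) (3 ^ d) ⟩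
    j * (3 ^ d * 3 ^ s) * 2 ^ q  ≡⟨ cong (λ x → j * x * 2 ^ q) (^-distribˡ-+-* 3 d s) ⟨
    j * 3 ^ (d + s) * 2 ^ q      ≤⟨ chainLength-last {j * 3 ^ (d + s)} {n} len≡1+q ⟩
    n                            ∎))
    where
    open ≤-Reasoning
    interchange : ∀ a b c d → a * b * c * d ≡ a * (d * b) * c
    interchange = solve-∀

  rows-below : ∀ s q → 12 * (j * 3 ^ s * 2 ^ q) ≤ n →
               2 + q < rowSize n j (1 + s) × q < rowSize n j (2 + s)
  rows-below s q 12c≤n =
      <-rowSize (1 + s) (subst (_≤ n) (twelvefold j (3 ^ s) (2 ^ q)) 12c≤n)
    , <-rowSize (2 + s) (≤-trans (≤-reflexive (ninefold j (3 ^ s) (2 ^ q)))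
                                 (≤-trans (*-monoˡ-≤ (j * 3 ^ s * 2 ^ q) (m≤m+n 9 3)) 12c≤n))
    where
    twelvefold : ∀ a b c → 12 * (a * b * c) ≡ a * (3 * b) * (2 * (2 * c))
    twelvefold = solve-∀
    ninefold : ∀ a b c → a * (3 * (3 * b)) * c ≡ 9 * (a * b * c)
    ninefold = solve-∀

  4-unit-next-row : ∀ s {i} → FirstOf4Unit n j s i → 12 * i ≤ n →
                    rowSize n j s < rowSize n j (suc s) + 2
  4-unit-next-row s unit 12i≤n with 4-unit-shape {n} {j} {s} unit
  ... | q , r≡4+q , refl = begin-strict
    rowSize n j s            ≡⟨ r≡4+q ⟩
    4 + q                    <⟨ ≤-reflexive (+-comm 2 (3 + q)) ⟩
    3 + q + 2                ≤⟨ +-monoˡ-≤ 2 (proj₁ (rows-below s q 12i≤n)) ⟩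
    rowSize n j (suc s) + 2  ∎
    where open ≤-Reasoning

  layerSize≢9 : ∀ s q → rowSize n j s ≡ 4 + q → 12 * (j * 3 ^ s * 2 ^ q) ≤ n →
                layerSize n j ≢ 9
  layerSize≢9 (suc s) q r≡4+q 12c≤n = >⇒≢ (begin-strict
    9                            <⟨ n≤1+n 10 ⟩
    4 + 4 + 3                    ≤⟨ +-mono-≤ (+-mono-≤ 4≤f[s] 4≤f[1+s]) 3≤f[2+s] ⟩
    f s + f (1 + s) + f (2 + s)  ≤⟨ prefixSum-window f s (s≤s (rowSize-nonempty (1 + s) f[1+s]>0)) ⟩
    layerSize n j                ∎)
    where
    open ≤-Reasoning
    f : ℕ → ℕ
    f = rowSize n j
    4≤f[1+s] : 4 ≤ f (1 + s)
    4≤f[1+s] = ≤-trans (m≤m+n 4 q) (≤-reflexive (sym r≡4+q))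
    f[1+s]>0 : 0 < f (1 + s)
    f[1+s]>0 = ≤-trans (s≤s z≤n) 4≤f[1+s]
    4≤f[s] : 4 ≤ f s
    4≤f[s] = ≤-trans 4≤f[1+s] (rowSize-shift s 0 1 (s≤s z≤n))
    3≤f[2+s] : 3 ≤ f (2 + s)
    3≤f[2+s] = ≤-trans (m≤m+n 3 q) (proj₁ (rows-below (suc s) q 12c≤n))
  layerSize≢9 zero (suc q) r≡4+q 12c≤n = >⇒≢ (begin-strict
    9                  <⟨ ≤-refl ⟩
    5 + 4 + 1          ≤⟨ +-mono-≤ (+-mono-≤ (≤-trans (m≤m+n 5 q) (≤-reflexive (sym r≡4+q)))
                                             (≤-trans (m≤m+n 4 q) 4+q≤f1))
                                   (≤-trans (s≤s z≤n) (proj₂ (rows-below 0 (suc q) 12c≤n))) ⟩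
    f 0 + f 1 + f 2    ≤⟨ prefixSum-window f 0 (s≤s (rowSize-nonempty 1 (≤-trans (s≤s z≤n) 4+q≤f1))) ⟩
    layerSize n j      ∎)
    where
    open ≤-Reasoning
    f : ℕ → ℕ
    f = rowSize n j
    4+q≤f1 : 3 + suc q ≤ f 1
    4+q≤f1 = proj₁ (rows-below 0 (suc q) 12c≤n)
  layerSize≢9 zero zero r≡4 12c≤n = <⇒≢ (begin-strict
    layerSize n j            ≡⟨ prefixSum-vanishing f (λ {k} 3≤k → n≤0⇒n≡0 (row-bound 4 k (2^4≤3^k 3≤k))) 3≤1+n ⟩
    f 0 + (f 1 + (f 2 + 0))  ≤⟨ +-mono-≤ (≤-reflexive r≡4) (+-mono-≤ (row-bound 1 1 (s≤s (s≤s z≤n)))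
                                                               (+-monoˡ-≤ 0 (row-bound 3 2 (n≤1+n 8)))) ⟩
    8                        <⟨ ≤-refl ⟩
    9                        ∎)
    where
    open ≤-Reasoning
    f : ℕ → ℕ
    f = rowSize n j
    row-bound : ∀ e d → 2 ^ e ≤ 3 ^ d → f d ≤ 4 ∸ e
    row-bound e d 2^e≤3^d = begin
      f d            ≡⟨ cong f (+-identityʳ d) ⟨
      f (d + 0)      ≤⟨ rowSize-shift 0 e d 2^e≤3^d ⟩
      f 0 ∸ e        ≡⟨ cong (_∸ e) r≡4 ⟩
      4 ∸ e          ∎
    2^4≤3^k : ∀ {k} → 3 ≤ k → 2 ^ 4 ≤ 3 ^ k
    2^4≤3^k 3≤k = ≤-trans (m≤m+n 16 11) (^-monoʳ-≤ 3 3≤k)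
    3≤1+n : 3 ≤ suc n
    3≤1+n = s≤s (rowSize-nonempty 1 (≤-trans (s≤s z≤n) (proj₁ (rows-below 0 0 12c≤n))))

  4-unit-layerSize≢9 : ∀ s {i} → FirstOf4Unit n j s i → 12 * i ≤ n → layerSize n j ≢ 9
  4-unit-layerSize≢9 s unit 12i≤n with 4-unit-shape {n} {j} {s} unit
  ... | q , r≡4+q , refl = layerSize≢9 s q r≡4+q 12i≤n

open Rows

lemmaC4 : (n : ℕ) → 1 ≤ n → (i : ℕ) → FirstOfSpecialUnit n i → n < 12 * i
lemmaC4 n _ i (inj₁ (j , s , (1≤j , _) , _ , |L|≡9 , unit)) =
  ≰⇒> λ 12i≤n → 4-unit-layerSize≢9 1≤j s unit 12i≤n |L|≡9
lemmaC4 n _ i (inj₂ (inj₁ (j , (1≤j , _) , _ , _ , r₀≡r₁+2 , unit))) =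
  ≰⇒> λ 12i≤n → <-irrefl r₀≡r₁+2 (4-unit-next-row 1≤j 0 unit 12i≤n)
lemmaC4 n _ i (inj₂ (inj₂ (j , s , (1≤j , _) , _ , unit , _ , _ , r≡r′+2))) =
  ≰⇒> λ 12i≤n → <-irrefl r≡r′+2 (4-unit-next-row 1≤j (suc s) unit 12i≤n)
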